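{- Let $p,q$ be natural numbers such that the sequence $n_{\mathcal T}=\sum_{i=1}^{n}q^{n-i}p^{i-1}$ ($n\ge1$) consists of positive integers, with associated $\mathcal T$-nomial coefficients $\binom{n}{k}_{\mathcal T}$. Let $n\ge1$ and suppose there are $n$ boxes, the $i$-th box containing $\lambda^n_i=q^{i-1}p^{n-i}$ distinguishable balls ($i=1,\dots,n$). For $k\ge0$: (a) $\binom{n+k-1}{k}_{\mathcal T}$ equals the number of ways to select $k$ balls with box repetition allowed, i.e. the number of pairs consisting of a sequence of boxes $1\le b_1\le\cdots\le b_k\le n$ and a choice, for each $j=1,\dots,k$, of a ball in box $b_j$; (b) $\binom{n}{k}_{\mathcal T}q^{\binom{k}{2}}p^{\binom{k}{2}}$ equals the number of ways to select $k$ balls without box repetition, i.e. the number of pairs consisting of boxes $1\le b_1<\cdots<b_k\le n$ and a choice, for each $j$, of a ball in box $b_j$.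
   Context: The sequence $\mathcal T=(n_{\mathcal T})_{n\ge1}$ is defined by $n_{\mathcal T}=[x^n]\,\frac{x}{(1-px)(1-qx)}=\sum_{i=1}^{n}q^{n-i}p^{i-1}$. Put $n_{\mathcal T}!=n_{\mathcal T}(n-1)_{\mathcal T}\cdots 1_{\mathcal T}$, $0_{\mathcal T}!=1$, and for integers $0\le k\le n$ define $\binom{n}{k}_{\mathcal T}=\frac{n_{\mathcal T}!}{k_{\mathcal T}!\,(n-k)_{\mathcal T}!}$; set $\binom{n}{k}_{\mathcal T}=0$ for $k>n$. -}

module Defs where

open import Data.Nat using (ℕ; zero; suc; _+_; _*_; _∸_; _^_; _≤_; _<_; _≤?_; NonZero; >-nonZero; s≤s; z≤n)
open import Data.Nat.Properties using (*-mono-<; ≤-refl)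
open import Data.List using (map; upTo)
open import Data.Nat.ListAction using (sum)
open import Data.Integer using (+_)
open import Data.Rational using (ℚ; _/_; 0ℚ)
open import Data.Fin as Fin using (Fin; toℕ)
open import Data.Vec using (Vec)
open import Data.Vec.Relation.Unary.All using (All)
open import Data.Vec.Relation.Unary.Linked using (Linked)
open import Data.Product using (Σ; _×_)
open import Relation.Nullary using (yes; no)

-- n_T = Σ_{i=1}^{n} q^{n-i} p^{i-1}   (written with i ↦ i+1, i = 0 .. n-1)
Tnum : ℕ → ℕ → ℕ → ℕ
Tnum p q n = sum (map (λ i → q ^ (n ∸ suc i) * p ^ i) (upTo n))

Tfact : ℕ → ℕ → ℕ → ℕ
Tfact p q zero    = 1
Tfact p q (suc n) = Tnum p q (suc n) * Tfact p q n

TPositive : ℕ → ℕ → Set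
TPositive p q = ∀ m → 1 ≤ m → 0 < Tnum p q m

Tfact-pos : ∀ {p q} → TPositive p q → ∀ n → 0 < Tfact p q n
Tfact-pos pos zero    = s≤s z≤n
Tfact-pos pos (suc n) = *-mono-< (pos (suc n) (s≤s z≤n)) (Tfact-pos pos n)

Tbinom : (p q : ℕ) → TPositive p q → ℕ → ℕ → ℚ
Tbinom p q pos n k with k ≤? n
... | no _  = 0ℚ
... | yes _ = (+ Tfact p q n) / (Tfact p q k * Tfact p q (n ∸ k))
  where instance
          nz : NonZero (Tfact p q k * Tfact p q (n ∸ k))
          nz = >-nonZero (*-mono-< (Tfact-pos pos k) (Tfact-pos pos (n ∸ k)))

-- number of balls in box i (boxes indexed by b : Fin n, i = toℕ b + 1):
-- λ^n_i = q^{i-1} p^{n-i}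
balls : (p q n : ℕ) → Fin n → ℕ
balls p q n b = q ^ toℕ b * p ^ (n ∸ suc (toℕ b))

SelRep : (p q n k : ℕ) → Set
SelRep p q n k =
  Σ (Vec (Fin n) k) λ bs → Linked Fin._≤_ bs × All (λ b → Fin (balls p q n b)) bs

SelNoRep : (p q n k : ℕ) → Set
SelNoRep p q n k =
  Σ (Vec (Fin n) k) λ bs → Linked Fin._<_ bs × All (λ b → Fin (balls p q n b)) bs

module Submission where

-- Selections of k balls with (without) box repetition are counted by the complete (elementary)
-- symmetric polynomial h_k (e_k) of the box sizes λ_1, …, λ_n: splitting on whether the first ball
-- comes from box 1 realises h_k(λ) = λ_1 h_{k-1}(λ) + h_k(λ_2, …) and
-- e_k(λ) = λ_1 e_{k-1}(λ_2, …) + e_k(λ_2, …) as bijections.  Since λ^{n+1}_1 = p^n and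
-- λ^{n+1}_{i+1} = q λ^n_i, these recurrences become T-Pascal rules, which together with
-- (a+b)_T = p^a b_T + q^b a_T give h_k(λ^{n+1}) k_T! n_T! = (n+k)_T! and
-- e_k(λ^{m+k}) k_T! m_T! = (m+k)_T! (qp)^{C(k,2)} by induction; dividing gives both identities in ℚ.

module Selections where

  open import Data.Nat using (ℕ; zero; suc; _+_; _*_; z≤n; s≤s)
  import Data.Nat as ℕ
  open import Data.Nat.Properties using (≤-irrelevant)
  open import Data.Fin using (Fin; zero; suc; _≤_; _<_)
  open import Data.Fin.Properties using (0↔⊥; 1↔⊤; +↔⊎; *↔×)
  open import Data.Vec using (Vec; []; _∷_)
  open import Data.Vec.Relation.Unary.All using (All; []; _∷_)
  open import Data.Vec.Relation.Unary.Linked using (Linked; []; [-]; _∷_)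
  open import Data.Product using (Σ; _×_; _,_; proj₁; proj₂)
  open import Data.Product.Function.NonDependent.Propositional using (_×-↔_)
  open import Data.Product.Function.Dependent.Propositional using (Σ-↔)
  open import Data.Sum using (_⊎_; inj₁; inj₂)
  open import Data.Sum.Function.Propositional using (_⊎-↔_)
  open import Data.Empty using (⊥)
  open import Data.Unit using (⊤)
  open import Function using (_∘_)
  open import Function.Bundles using (_↔_; mk↔ₛ′)
  open import Function.Properties.Inverse using (↔-refl; ↔-sym; ↔-trans)
  open import Function.Related.Propositional using (module EquationalReasoning; bijection)
  open import Relation.Nullary using (¬_; Irrelevant; contradiction)
  open import Relation.Binary.PropositionalEquality using (_≡_; refl; cong)

  Σ-Fin-suc : ∀ {n} (A : Fin (suc n) → Set) → Σ (Fin (suc n)) A ↔ (A zero ⊎ Σ (Fin n) (λ i → A (suc i)))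
  Σ-Fin-suc A = mk↔ₛ′ to from (λ { (inj₁ _) → refl ; (inj₂ _) → refl })
                              (λ { (zero , _) → refl ; (suc _ , _) → refl })
    where
    to : Σ _ A → A zero ⊎ Σ _ (λ i → A (suc i))
    to (zero  , a) = inj₁ a
    to (suc i , a) = inj₂ (i , a)
    from : A zero ⊎ Σ _ (λ i → A (suc i)) → Σ _ A
    from (inj₁ a)       = zero , a
    from (inj₂ (i , a)) = suc i , a

  ⊎-cancelˡ-¬ : ∀ {A B : Set} → ¬ A → (A ⊎ B) ↔ B
  ⊎-cancelˡ-¬ ¬a = mk↔ₛ′ (λ { (inj₁ a) → contradiction a ¬a ; (inj₂ b) → b }) inj₂ (λ _ → refl)
    (λ { (inj₁ a) → contradiction a ¬a ; (inj₂ b) → refl })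

  ×-cancelˡ-irrelevant : ∀ {P A : Set} → P → Irrelevant P → (P × A) ↔ A
  ×-cancelˡ-irrelevant p irr = mk↔ₛ′ proj₂ (p ,_) (λ _ → refl) (λ (p′ , a) → cong (_, a) (irr p p′))

  s≤s↔ : ∀ {m n} → (suc m ℕ.≤ suc n) ↔ (m ℕ.≤ n)
  s≤s↔ = mk↔ₛ′ (λ { (s≤s le) → le }) s≤s (λ _ → refl) (λ { (s≤s _) → refl })

  complete : (n k : ℕ) → (Fin n → ℕ) → ℕ
  complete n       zero    f = 1
  complete zero    (suc k) f = 0
  complete (suc n) (suc k) f = f zero * complete (suc n) k f + complete n (suc k) (f ∘ suc)

  elementary : (n k : ℕ) → (Fin n → ℕ) → ℕ
  elementary n       zero    f = 1
  elementary zero    (suc k) f = 0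
  elementary (suc n) (suc k) f = f zero * elementary n k (f ∘ suc) + elementary n (suc k) (f ∘ suc)

  module _ (R : ∀ {n} → Fin n → Fin n → Set) where

    Sel : (n k : ℕ) → (Fin n → ℕ) → Set
    Sel n k f = Σ (Vec (Fin n) k) λ bs → Linked R bs × All (λ b → Fin (f b)) bs

    SelAfter : (n k : ℕ) → (Fin n → ℕ) → Fin n → Set
    SelAfter n k f b = Σ (Vec (Fin n) k) λ bs → Linked R (b ∷ bs) × All (λ c → Fin (f c)) bs

    Sel-[]↔⊤ : ∀ {n f} → Sel n 0 f ↔ ⊤
    Sel-[]↔⊤ = mk↔ₛ′ _ (λ _ → [] , [] , []) (λ _ → refl) (λ { ([] , [] , []) → refl })

    SelAfter-[]↔⊤ : ∀ {n f b} → SelAfter n 0 f b ↔ ⊤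
    SelAfter-[]↔⊤ = mk↔ₛ′ _ (λ _ → [] , [-] , []) (λ _ → refl) (λ { ([] , [-] , []) → refl })

    Sel-Fin0↔⊥ : ∀ {k f} → Sel 0 (suc k) f ↔ ⊥
    Sel-Fin0↔⊥ = mk↔ₛ′ (λ { ((() ∷ _) , _) }) (λ ()) (λ ()) (λ { ((() ∷ _) , _) })

    Sel-∷ : ∀ {n k f} → Sel n (suc k) f ↔ Σ (Fin n) λ b → Fin (f b) × SelAfter n k f b
    Sel-∷ = mk↔ₛ′ (λ { ((b ∷ bs) , l , (x ∷ a)) → b , x , bs , l , a })
      (λ (b , x , bs , l , a) → (b ∷ bs) , l , (x ∷ a))
      (λ _ → refl) (λ { ((_ ∷ _) , _ , (_ ∷ _)) → refl })

    SelAfter-∷ : ∀ {n k f b} → SelAfter n (suc k) f b ↔ Σ (Fin n) λ c → R b c × Fin (f c) × SelAfter n k f c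
    SelAfter-∷ = mk↔ₛ′ (λ { ((c ∷ bs) , (r ∷ l) , (x ∷ a)) → c , r , x , bs , l , a })
      (λ (c , r , x , bs , l , a) → (c ∷ bs) , (r ∷ l) , (x ∷ a))
      (λ _ → refl) (λ { ((_ ∷ _) , (_ ∷ _) , (_ ∷ _)) → refl })

    -- A sequence continuing a box other than the first never visits the first box again.
    module _ (R-suc↔ : ∀ {n} {b c : Fin n} → R (suc b) (suc c) ↔ R b c)
             (R-suc-zero : ∀ {n} {b : Fin n} → ¬ R (suc b) zero) where

      SelAfter-suc : ∀ n k (f : Fin (suc n) → ℕ) b → SelAfter (suc n) k f (suc b) ↔ SelAfter n k (f ∘ suc) b
      SelAfter-suc n zero    f b = ↔-trans SelAfter-[]↔⊤ (↔-sym SelAfter-[]↔⊤)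
      SelAfter-suc n (suc k) f b = begin
        SelAfter (suc n) (suc k) f (suc b)
          ↔⟨ SelAfter-∷ ⟩
        Σ (Fin (suc n)) (λ c → R (suc b) c × Fin (f c) × SelAfter (suc n) k f c)
          ↔⟨ Σ-Fin-suc _ ⟩
        ((R (suc b) zero × Fin (f zero) × SelAfter (suc n) k f zero)
          ⊎ Σ (Fin n) (λ c → R (suc b) (suc c) × Fin (f (suc c)) × SelAfter (suc n) k f (suc c)))
          ↔⟨ ⊎-cancelˡ-¬ (R-suc-zero ∘ proj₁) ⟩
        Σ (Fin n) (λ c → R (suc b) (suc c) × Fin (f (suc c)) × SelAfter (suc n) k f (suc c))
          ↔⟨ Σ-↔ ↔-refl (R-suc↔ ×-↔ ↔-refl ×-↔ SelAfter-suc n k f _) ⟩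
        Σ (Fin n) (λ c → R b c × Fin (f (suc c)) × SelAfter n k (f ∘ suc) c)
          ↔⟨ SelAfter-∷ ⟨
        SelAfter n (suc k) (f ∘ suc) b ∎
        where open EquationalReasoning {k = bijection}

      Sel-suc : ∀ n k (f : Fin (suc n) → ℕ) →
                Sel (suc n) (suc k) f ↔ ((Fin (f zero) × SelAfter (suc n) k f zero) ⊎ Sel n (suc k) (f ∘ suc))
      Sel-suc n k f = begin
        Sel (suc n) (suc k) f
          ↔⟨ Sel-∷ ⟩
        Σ (Fin (suc n)) (λ b → Fin (f b) × SelAfter (suc n) k f b)
          ↔⟨ Σ-Fin-suc _ ⟩
        ((Fin (f zero) × SelAfter (suc n) k f zero) ⊎ Σ (Fin n) (λ b → Fin (f (suc b)) × SelAfter (suc n) k f (suc b)))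
          ↔⟨ ↔-refl ⊎-↔ Σ-↔ ↔-refl (↔-refl ×-↔ SelAfter-suc n k f _) ⟩
        ((Fin (f zero) × SelAfter (suc n) k f zero) ⊎ Σ (Fin n) (λ b → Fin (f (suc b)) × SelAfter n k (f ∘ suc) b))
          ↔⟨ ↔-refl ⊎-↔ Sel-∷ ⟨
        ((Fin (f zero) × SelAfter (suc n) k f zero) ⊎ Sel n (suc k) (f ∘ suc)) ∎
        where open EquationalReasoning {k = bijection}

  SelAfter≤-zero : ∀ n k (f : Fin (suc n) → ℕ) → SelAfter _≤_ (suc n) k f zero ↔ Sel _≤_ (suc n) k f
  SelAfter≤-zero n k f = Σ-↔ ↔-refl (Linked-zero∷ _ ×-↔ ↔-refl)
    where
    Linked-zero∷ : ∀ {m} (bs : Vec (Fin (suc n)) m) → Linked _≤_ (zero ∷ bs) ↔ Linked _≤_ bs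
    Linked-zero∷ []      = mk↔ₛ′ (λ _ → []) (λ _ → [-]) (λ { [] → refl }) (λ { [-] → refl })
    Linked-zero∷ (_ ∷ _) = mk↔ₛ′ (λ { (_ ∷ l) → l }) (z≤n ∷_) (λ _ → refl) (λ { (z≤n ∷ _) → refl })

  SelAfter<-zero : ∀ n k (f : Fin (suc n) → ℕ) → SelAfter _<_ (suc n) k f zero ↔ Sel _<_ n k (f ∘ suc)
  SelAfter<-zero n zero    f = ↔-trans (SelAfter-[]↔⊤ _<_) (↔-sym (Sel-[]↔⊤ _<_))
  SelAfter<-zero n (suc k) f = begin
    SelAfter _<_ (suc n) (suc k) f zero
      ↔⟨ SelAfter-∷ _<_ ⟩
    Σ (Fin (suc n)) (λ c → zero {n} < c × Fin (f c) × SelAfter _<_ (suc n) k f c)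
      ↔⟨ Σ-Fin-suc _ ⟩
    ((zero {n} < zero {n} × Fin (f zero) × SelAfter _<_ (suc n) k f zero)
      ⊎ Σ (Fin n) (λ c → zero {n} < suc c × Fin (f (suc c)) × SelAfter _<_ (suc n) k f (suc c)))
      ↔⟨ ⊎-cancelˡ-¬ (λ ()) ⟩
    Σ (Fin n) (λ c → zero {n} < suc c × Fin (f (suc c)) × SelAfter _<_ (suc n) k f (suc c))
      ↔⟨ Σ-↔ ↔-refl (×-cancelˡ-irrelevant (s≤s z≤n) ≤-irrelevant) ⟩
    Σ (Fin n) (λ c → Fin (f (suc c)) × SelAfter _<_ (suc n) k f (suc c))
      ↔⟨ Σ-↔ ↔-refl (↔-refl ×-↔ SelAfter-suc _<_ s≤s↔ (λ ()) n k f _) ⟩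
    Σ (Fin n) (λ c → Fin (f (suc c)) × SelAfter _<_ n k (f ∘ suc) c)
      ↔⟨ Sel-∷ _<_ ⟨
    Sel _<_ n (suc k) (f ∘ suc) ∎
    where open EquationalReasoning {k = bijection}

  Fin-complete↔Sel≤ : ∀ n k (f : Fin n → ℕ) → Fin (complete n k f) ↔ Sel _≤_ n k f
  Fin-complete↔Sel≤ n       zero    f = ↔-trans 1↔⊤ (↔-sym (Sel-[]↔⊤ _≤_))
  Fin-complete↔Sel≤ zero    (suc k) f = ↔-trans 0↔⊥ (↔-sym (Sel-Fin0↔⊥ _≤_))
  Fin-complete↔Sel≤ (suc n) (suc k) f = begin
    Fin (f zero * complete (suc n) k f + complete n (suc k) (f ∘ suc))
      ↔⟨ +↔⊎ ⟩
    (Fin (f zero * complete (suc n) k f) ⊎ Fin (complete n (suc k) (f ∘ suc)))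
      ↔⟨ *↔× ⊎-↔ ↔-refl ⟩
    ((Fin (f zero) × Fin (complete (suc n) k f)) ⊎ Fin (complete n (suc k) (f ∘ suc)))
      ↔⟨ (↔-refl ×-↔ Fin-complete↔Sel≤ (suc n) k f) ⊎-↔ Fin-complete↔Sel≤ n (suc k) (f ∘ suc) ⟩
    ((Fin (f zero) × Sel _≤_ (suc n) k f) ⊎ Sel _≤_ n (suc k) (f ∘ suc))
      ↔⟨ (↔-refl ×-↔ SelAfter≤-zero n k f) ⊎-↔ ↔-refl ⟨
    ((Fin (f zero) × SelAfter _≤_ (suc n) k f zero) ⊎ Sel _≤_ n (suc k) (f ∘ suc))
      ↔⟨ Sel-suc _≤_ s≤s↔ (λ ()) n k f ⟨
    Sel _≤_ (suc n) (suc k) f ∎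
    where open EquationalReasoning {k = bijection}

  Fin-elementary↔Sel< : ∀ n k (f : Fin n → ℕ) → Fin (elementary n k f) ↔ Sel _<_ n k f
  Fin-elementary↔Sel< n       zero    f = ↔-trans 1↔⊤ (↔-sym (Sel-[]↔⊤ _<_))
  Fin-elementary↔Sel< zero    (suc k) f = ↔-trans 0↔⊥ (↔-sym (Sel-Fin0↔⊥ _<_))
  Fin-elementary↔Sel< (suc n) (suc k) f = begin
    Fin (f zero * elementary n k (f ∘ suc) + elementary n (suc k) (f ∘ suc))
      ↔⟨ +↔⊎ ⟩
    (Fin (f zero * elementary n k (f ∘ suc)) ⊎ Fin (elementary n (suc k) (f ∘ suc)))
      ↔⟨ *↔× ⊎-↔ ↔-refl ⟩
    ((Fin (f zero) × Fin (elementary n k (f ∘ suc))) ⊎ Fin (elementary n (suc k) (f ∘ suc)))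
      ↔⟨ (↔-refl ×-↔ Fin-elementary↔Sel< n k (f ∘ suc)) ⊎-↔ Fin-elementary↔Sel< n (suc k) (f ∘ suc) ⟩
    ((Fin (f zero) × Sel _<_ n k (f ∘ suc)) ⊎ Sel _<_ n (suc k) (f ∘ suc))
      ↔⟨ (↔-refl ×-↔ SelAfter<-zero n k f) ⊎-↔ ↔-refl ⟨
    ((Fin (f zero) × SelAfter _<_ (suc n) k f zero) ⊎ Sel _<_ n (suc k) (f ∘ suc))
      ↔⟨ Sel-suc _<_ s≤s↔ (λ ()) n k f ⟨
    Sel _<_ (suc n) (suc k) f ∎
    where open EquationalReasoning {k = bijection}

module TFactorials where

  open import Defs
  open import Data.Nat using (ℕ; zero; suc; _+_; _*_; _∸_; _^_; _<_; s≤s)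
  open import Data.Nat.Properties
  open import Data.Nat.Tactic.RingSolver using (solve-∀)
  open import Data.Nat.Combinatorics using (_C_; nC1≡n; nCk+nC[k+1]≡[n+1]C[k+1])
  open import Data.Nat.ListAction using (sum)
  open import Data.List using (map; applyUpTo)
  open import Data.List.Properties using (map-upTo; map-applyUpTo)
  open import Data.Fin using (Fin; zero; suc; toℕ)
  open import Function using (_∘_)
  open import Relation.Binary.PropositionalEquality
  open ≡-Reasoning
  open Selections using (complete; elementary)

  sum-applyUpTo-scale : ∀ c (f g : ℕ → ℕ) n → (∀ i → f i ≡ c * g i) →
                        sum (applyUpTo f n) ≡ c * sum (applyUpTo g n)
  sum-applyUpTo-scale c f g zero    f≡cg = sym (*-zeroʳ c)
  sum-applyUpTo-scale c f g (suc n) f≡cg = begin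
    f 0 + sum (applyUpTo (f ∘ suc) n)
      ≡⟨ cong₂ _+_ (f≡cg 0) (sum-applyUpTo-scale c (f ∘ suc) (g ∘ suc) n (f≡cg ∘ suc)) ⟩
    c * g 0 + c * sum (applyUpTo (g ∘ suc) n)
      ≡⟨ *-distribˡ-+ c (g 0) _ ⟨
    c * sum (applyUpTo g (suc n)) ∎

  complete-scale : ∀ n k c (f g : Fin n → ℕ) → (∀ i → f i ≡ c * g i) →
                   complete n k f ≡ c ^ k * complete n k g
  complete-scale n       zero    c f g f≡cg = refl
  complete-scale zero    (suc k) c f g f≡cg = sym (*-zeroʳ (c ^ suc k))
  complete-scale (suc n) (suc k) c f g f≡cg = begin
    f zero * complete (suc n) k f + complete n (suc k) (f ∘ suc)
      ≡⟨ cong₂ _+_ (cong₂ _*_ (f≡cg zero) (complete-scale (suc n) k c f g f≡cg))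
                   (complete-scale n (suc k) c _ _ (f≡cg ∘ suc)) ⟩
    c * g zero * (c ^ k * complete (suc n) k g) + c * c ^ k * complete n (suc k) (g ∘ suc)
      ≡⟨ factor c (g zero) (c ^ k) _ _ ⟩
    c * c ^ k * (g zero * complete (suc n) k g + complete n (suc k) (g ∘ suc)) ∎
    where factor : ∀ c a ck x y → c * a * (ck * x) + c * ck * y ≡ c * ck * (a * x + y)
          factor = solve-∀

  elementary-scale : ∀ n k c (f g : Fin n → ℕ) → (∀ i → f i ≡ c * g i) →
                     elementary n k f ≡ c ^ k * elementary n k g
  elementary-scale n       zero    c f g f≡cg = refl
  elementary-scale zero    (suc k) c f g f≡cg = sym (*-zeroʳ (c ^ suc k))
  elementary-scale (suc n) (suc k) c f g f≡cg = begin
    f zero * elementary n k (f ∘ suc) + elementary n (suc k) (f ∘ suc)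
      ≡⟨ cong₂ _+_ (cong₂ _*_ (f≡cg zero) (elementary-scale n k c _ _ (f≡cg ∘ suc)))
                   (elementary-scale n (suc k) c _ _ (f≡cg ∘ suc)) ⟩
    c * g zero * (c ^ k * elementary n k (g ∘ suc)) + c * c ^ k * elementary n (suc k) (g ∘ suc)
      ≡⟨ factor c (g zero) (c ^ k) _ _ ⟩
    c * c ^ k * (g zero * elementary n k (g ∘ suc) + elementary n (suc k) (g ∘ suc)) ∎
    where factor : ∀ c a ck x y → c * a * (ck * x) + c * ck * y ≡ c * ck * (a * x + y)
          factor = solve-∀

  elementary-vanishes : ∀ n k (f : Fin n → ℕ) → n < k → elementary n k f ≡ 0
  elementary-vanishes zero    (suc k) f _         = refl
  elementary-vanishes (suc n) (suc k) f (s≤s n<k) = begin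
    f zero * elementary n k (f ∘ suc) + elementary n (suc k) (f ∘ suc)
      ≡⟨ cong₂ (λ x y → f zero * x + y) (elementary-vanishes n k _ n<k)
                                        (elementary-vanishes n (suc k) _ (m<n⇒m<1+n n<k)) ⟩
    f zero * 0 + 0 ≡⟨ trans (+-identityʳ _) (*-zeroʳ (f zero)) ⟩
    0              ∎

  [1+k]C2≡k+kC2 : ∀ k → suc k C 2 ≡ k + k C 2
  [1+k]C2≡k+kC2 k = trans (sym (nCk+nC[k+1]≡[n+1]C[k+1] k 1)) (cong (_+ k C 2) (nC1≡n k))

  module _ (p q : ℕ) where

    private
      T = Tnum p q
      F = Tfact p q

    Tnum-suc : ∀ n → T (suc n) ≡ q ^ n + p * T n
    Tnum-suc n = begin
      q ^ n * 1 + sum (map term (applyUpTo suc n)) ≡⟨ cong₂ _+_ (*-identityʳ (q ^ n)) (cong sum (map-applyUpTo suc term n)) ⟩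
      q ^ n + sum (applyUpTo (term ∘ suc) n)       ≡⟨ cong (q ^ n +_) (sum-applyUpTo-scale p _ term′ n shift) ⟩
      q ^ n + p * sum (applyUpTo term′ n)           ≡⟨ cong (λ s → q ^ n + p * sum s) (map-upTo term′ n) ⟨
      q ^ n + p * T n                               ∎
      where
      term term′ : ℕ → ℕ
      term  i = q ^ (suc n ∸ suc i) * p ^ i
      term′ i = q ^ (n ∸ suc i) * p ^ i
      shift : ∀ i → term (suc i) ≡ p * term′ i
      shift i = x*[y*z]≡y*[x*z] (q ^ (n ∸ suc i)) p (p ^ i)
        where x*[y*z]≡y*[x*z] : ∀ x y z → x * (y * z) ≡ y * (x * z)
              x*[y*z]≡y*[x*z] = solve-∀

    Tnum-+ : ∀ a b → T (a + b) ≡ p ^ a * T b + q ^ b * T a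
    Tnum-+ zero    b = sym (trans (cong (1 * T b +_) (*-zeroʳ (q ^ b))) (trans (+-identityʳ _) (*-identityˡ _)))
    Tnum-+ (suc a) b = begin
      T (suc (a + b))                                 ≡⟨ Tnum-suc (a + b) ⟩
      q ^ (a + b) + p * T (a + b)                     ≡⟨ cong₂ (λ x y → x + p * y) (^-distribˡ-+-* q a b) (Tnum-+ a b) ⟩
      q ^ a * q ^ b + p * (p ^ a * T b + q ^ b * T a) ≡⟨ regroup (q ^ a) (q ^ b) p (p ^ a) (T b) (T a) ⟩
      p * p ^ a * T b + q ^ b * (q ^ a + p * T a)     ≡⟨ cong (λ x → p * p ^ a * T b + q ^ b * x) (Tnum-suc a) ⟨
      p * p ^ a * T b + q ^ b * T (suc a)             ∎
      where regroup : ∀ qa qb p pa tb ta → qa * qb + p * (pa * tb + qb * ta) ≡ p * pa * tb + qb * (qa + p * ta)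
            regroup = solve-∀

    balls-suc : ∀ n (i : Fin n) → balls p q (suc n) (suc i) ≡ q * balls p q n i
    balls-suc n i = *-assoc q (q ^ toℕ i) _

    complete-balls-suc : ∀ n k → complete (suc n) (suc k) (balls p q (suc n))
                       ≡ p ^ n * complete (suc n) k (balls p q (suc n)) + q ^ suc k * complete n (suc k) (balls p q n)
    complete-balls-suc n k = cong₂ _+_ (cong (_* complete (suc n) k (balls p q (suc n))) (*-identityˡ (p ^ n)))
                                       (complete-scale n (suc k) q _ _ (balls-suc n))

    elementary-balls-suc : ∀ n k → elementary (suc n) (suc k) (balls p q (suc n))
                         ≡ p ^ n * (q ^ k * elementary n k (balls p q n)) + q ^ suc k * elementary n (suc k) (balls p q n)
    elementary-balls-suc n k = cong₂ _+_ (cong₂ _*_ (*-identityˡ (p ^ n)) (elementary-scale n k q _ _ (balls-suc n)))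
                                         (elementary-scale n (suc k) q _ _ (balls-suc n))

    complete-balls-Tfact : ∀ k n → complete (suc n) k (balls p q (suc n)) * F k * F n ≡ F (n + k)
    complete-balls-Tfact zero    n       = trans (+-identityʳ (F n)) (cong F (sym (+-identityʳ n)))
    complete-balls-Tfact (suc k) zero    = begin
      complete 1 (suc k) (balls p q 1) * F (suc k) * 1         ≡⟨ cong (λ x → x * F (suc k) * 1) (complete-balls-suc 0 k) ⟩
      (1 * h + q ^ suc k * 0) * (T (suc k) * F k) * 1          ≡⟨ regroup h (q ^ suc k) (T (suc k)) (F k) ⟩
      T (suc k) * (h * F k * 1)                                ≡⟨ cong (T (suc k) *_) (complete-balls-Tfact k 0) ⟩
      T (suc k) * F k                                          ∎
      where h = complete 1 k (balls p q 1)
            regroup : ∀ h qk t f → (1 * h + qk * 0) * (t * f) * 1 ≡ t * (h * f * 1)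
            regroup = solve-∀
    complete-balls-Tfact (suc k) (suc n) = begin
      complete (suc (suc n)) (suc k) (balls p q (suc (suc n))) * F (suc k) * F (suc n)
        ≡⟨ cong (λ x → x * F (suc k) * F (suc n)) (complete-balls-suc (suc n) k) ⟩
      (p ^ suc n * h₁ + q ^ suc k * h₂) * (T (suc k) * F k) * (T (suc n) * F n)
        ≡⟨ regroup (p ^ suc n) h₁ (q ^ suc k) h₂ (T (suc k)) (F k) (T (suc n)) (F n) ⟩
      p ^ suc n * T (suc k) * (h₁ * F k * F (suc n)) + q ^ suc k * T (suc n) * (h₂ * F (suc k) * F n)
        ≡⟨ cong₂ (λ x y → p ^ suc n * T (suc k) * x + q ^ suc k * T (suc n) * y)
                 (trans (complete-balls-Tfact k (suc n)) (cong F (sym (+-suc n k)))) (complete-balls-Tfact (suc k) n) ⟩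
      p ^ suc n * T (suc k) * F (n + suc k) + q ^ suc k * T (suc n) * F (n + suc k)
        ≡⟨ *-distribʳ-+ (F (n + suc k)) (p ^ suc n * T (suc k)) (q ^ suc k * T (suc n)) ⟨
      (p ^ suc n * T (suc k) + q ^ suc k * T (suc n)) * F (n + suc k)
        ≡⟨ cong (_* F (n + suc k)) (Tnum-+ (suc n) (suc k)) ⟨
      F (suc n + suc k) ∎
      where h₁ = complete (suc (suc n)) k (balls p q (suc (suc n)))
            h₂ = complete (suc n) (suc k) (balls p q (suc n))
            regroup : ∀ a h₁ b h₂ tk fk tn fn → (a * h₁ + b * h₂) * (tk * fk) * (tn * fn)
                    ≡ a * tk * (h₁ * fk * (tn * fn)) + b * tn * (h₂ * (tk * fk) * fn)
            regroup = solve-∀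

    weight : ℕ → ℕ
    weight k = q ^ (k C 2) * p ^ (k C 2)

    weight-suc : ∀ k → weight (suc k) ≡ weight k * (q ^ k * p ^ k)
    weight-suc k = begin
      q ^ (suc k C 2) * p ^ (suc k C 2)            ≡⟨ cong (λ i → q ^ i * p ^ i) ([1+k]C2≡k+kC2 k) ⟩
      q ^ (k + k C 2) * p ^ (k + k C 2)            ≡⟨ cong₂ _*_ (^-distribˡ-+-* q k (k C 2)) (^-distribˡ-+-* p k (k C 2)) ⟩
      q ^ k * q ^ (k C 2) * (p ^ k * p ^ (k C 2))  ≡⟨ regroup (q ^ k) (q ^ (k C 2)) (p ^ k) (p ^ (k C 2)) ⟩
      weight k * (q ^ k * p ^ k)                   ∎
      where regroup : ∀ a b c d → a * b * (c * d) ≡ b * d * (a * c)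
            regroup = solve-∀

    elementary-balls-Tfact : ∀ m k → elementary (m + k) k (balls p q (m + k)) * F k * F m ≡ F (m + k) * weight k
    elementary-balls-Tfact m       zero    =
      trans (*-identityˡ (F m)) (trans (cong F (sym (+-identityʳ m))) (sym (*-identityʳ _)))
    elementary-balls-Tfact zero    (suc k) = begin
      elementary (suc k) (suc k) (balls p q (suc k)) * F (suc k) * 1
        ≡⟨ cong (λ x → x * F (suc k) * 1) (elementary-balls-suc k k) ⟩
      (p ^ k * (q ^ k * e) + q ^ suc k * elementary k (suc k) (balls p q k)) * (T (suc k) * F k) * 1
        ≡⟨ cong (λ x → (p ^ k * (q ^ k * e) + q ^ suc k * x) * (T (suc k) * F k) * 1)
                (elementary-vanishes k (suc k) _ ≤-refl) ⟩
      (p ^ k * (q ^ k * e) + q ^ suc k * 0) * (T (suc k) * F k) * 1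
        ≡⟨ regroup (p ^ k) (q ^ k) e (q ^ suc k) (T (suc k)) (F k) ⟩
      T (suc k) * (q ^ k * p ^ k) * (e * F k * 1)
        ≡⟨ cong (T (suc k) * (q ^ k * p ^ k) *_) (elementary-balls-Tfact zero k) ⟩
      T (suc k) * (q ^ k * p ^ k) * (F k * weight k)
        ≡⟨ regroup′ (T (suc k)) (q ^ k * p ^ k) (F k) (weight k) ⟩
      T (suc k) * F k * (weight k * (q ^ k * p ^ k))
        ≡⟨ cong (T (suc k) * F k *_) (weight-suc k) ⟨
      F (suc k) * weight (suc k) ∎
      where e = elementary k k (balls p q k)
            regroup : ∀ pk qk e qsk t f → (pk * (qk * e) + qsk * 0) * (t * f) * 1 ≡ t * (qk * pk) * (e * f * 1)
            regroup = solve-∀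
            regroup′ : ∀ t x f w → t * x * (f * w) ≡ t * f * (w * x)
            regroup′ = solve-∀
    elementary-balls-Tfact (suc m) (suc k) = begin
      elementary (suc N) (suc k) (balls p q (suc N)) * F (suc k) * F (suc m)
        ≡⟨ cong (λ x → x * F (suc k) * F (suc m)) (elementary-balls-suc N k) ⟩
      (p ^ N * (q ^ k * e₁) + q ^ suc k * e₂) * (T (suc k) * F k) * (T (suc m) * F m)
        ≡⟨ regroup (p ^ N) (q ^ k) e₁ (q ^ suc k) e₂ (T (suc k)) (F k) (T (suc m)) (F m) ⟩
      p ^ N * q ^ k * T (suc k) * (e₁ * F k * (T (suc m) * F m))
        + q ^ suc k * T (suc m) * (e₂ * (T (suc k) * F k) * F m)
        ≡⟨ cong₂ (λ x y → p ^ N * q ^ k * T (suc k) * x + q ^ suc k * T (suc m) * y)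
                 ih₁ (elementary-balls-Tfact m (suc k)) ⟩
      p ^ N * q ^ k * T (suc k) * (F N * weight k) + q ^ suc k * T (suc m) * (F N * weight (suc k))
        ≡⟨ cong₂ (λ x y → x * q ^ k * T (suc k) * (F N * weight k) + q ^ suc k * T (suc m) * (F N * y))
                 p^N≡ (weight-suc k) ⟩
      p ^ suc m * p ^ k * q ^ k * T (suc k) * (F N * weight k)
        + q ^ suc k * T (suc m) * (F N * (weight k * (q ^ k * p ^ k)))
        ≡⟨ regroup′ (p ^ suc m) (p ^ k) (q ^ k) (T (suc k)) (F N) (weight k) (q ^ suc k) (T (suc m)) ⟩
      (p ^ suc m * T (suc k) + q ^ suc k * T (suc m)) * F N * (weight k * (q ^ k * p ^ k))
        ≡⟨ cong₂ (λ x y → x * F N * y) (Tnum-+ (suc m) (suc k)) (weight-suc k) ⟨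
      F (suc m + suc k) * weight (suc k) ∎
      where N = m + suc k
            e₁ = elementary N k (balls p q N)
            e₂ = elementary N (suc k) (balls p q N)
            ih₁ : e₁ * F k * F (suc m) ≡ F N * weight k
            ih₁ = subst (λ n → elementary n k (balls p q n) * F k * F (suc m) ≡ F n * weight k)
                        (sym (+-suc m k)) (elementary-balls-Tfact (suc m) k)
            p^N≡ : p ^ N ≡ p ^ suc m * p ^ k
            p^N≡ = trans (cong (p ^_) (+-suc m k)) (^-distribˡ-+-* p (suc m) k)
            regroup : ∀ pN qk e₁ qsk e₂ tk fk tm fm → (pN * (qk * e₁) + qsk * e₂) * (tk * fk) * (tm * fm)
                    ≡ pN * qk * tk * (e₁ * fk * (tm * fm)) + qsk * tm * (e₂ * (tk * fk) * fm)
            regroup = solve-∀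
            regroup′ : ∀ psm pk qk tk fN w qsk tm → psm * pk * qk * tk * (fN * w) + qsk * tm * (fN * (w * (qk * pk)))
                     ≡ (psm * tk + qsk * tm) * fN * (w * (qk * pk))
            regroup′ = solve-∀

open import Defs
open import Data.Nat using (ℕ; _+_; _∸_; _≤_; _^_)
import Data.Nat as ℕ
open import Data.Nat.Combinatorics using (_C_)
open import Data.Integer using (+_)
open import Data.Rational using (ℚ; _*_; _/_)
open import Data.Fin using (Fin)
open import Data.Product using (Σ; _×_)
open import Function.Bundles using (_↔_)
open import Relation.Binary.PropositionalEquality using (_≡_)

open import Data.Nat using (suc; NonZero; >-nonZero; _≤?_; _<_)
import Data.Nat.Properties as ℕₚ
import Data.Integer as ℤ
open import Data.Integer.Properties using (pos-*)
import Data.Integer.Properties as ℤₚ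
open import Data.Rational using (0ℚ; toℚᵘ)
open import Data.Rational.Properties using (toℚᵘ-injective; toℚᵘ-fromℚᵘ; toℚᵘ-homo-*)
import Data.Rational.Properties as ℚₚ
import Data.Rational.Unnormalised as ℚᵘ
open import Data.Rational.Unnormalised using (mkℚᵘ; *≡*)
open import Data.Rational.Unnormalised.Properties using (*-cong; module ≃-Reasoning)
open import Data.Sum using (inj₁; inj₂)
open import Data.Product using (_,_)
open import Relation.Nullary using (yes; no; contradiction)
open import Relation.Binary.PropositionalEquality using (refl; sym; trans; cong; subst; module ≡-Reasoning)
open Selections using (complete; elementary; Fin-complete↔Sel≤; Fin-elementary↔Sel<)
open TFactorials using (weight; complete-balls-Tfact; elementary-balls-Tfact; elementary-vanishes)

/-*-/1 : ∀ a b m c .{{_ : NonZero b}} → a ℕ.* m ≡ c ℕ.* b → ((+ a) / b) * ((+ m) / 1) ≡ (+ c) / 1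
/-*-/1 a (suc b) m c am≡cb = toℚᵘ-injective (begin
  toℚᵘ (x * y)                         ≈⟨ toℚᵘ-homo-* x y ⟩
  toℚᵘ x ℚᵘ.* toℚᵘ y                   ≈⟨ *-cong (toℚᵘ-fromℚᵘ (mkℚᵘ (+ a) b)) (toℚᵘ-fromℚᵘ (mkℚᵘ (+ m) 0)) ⟩
  mkℚᵘ (+ a) b ℚᵘ.* mkℚᵘ (+ m) 0       ≈⟨ *≡* cross ⟩
  mkℚᵘ (+ c) 0                         ≈⟨ toℚᵘ-fromℚᵘ (mkℚᵘ (+ c) 0) ⟨
  toℚᵘ ((+ c) / 1)                     ∎)
  where
  open ≃-Reasoning
  x = (+ a) / suc b
  y = (+ m) / 1
  cross : (+ a ℤ.* + m) ℤ.* + 1 ≡ + c ℤ.* + (suc b ℕ.* 1)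
  cross = trans (ℤₚ.*-identityʳ _) (trans (sym (pos-* a m))
            (trans (cong +_ (trans am≡cb (cong (c ℕ.*_) (sym (ℕₚ.*-identityʳ (suc b)))))) (pos-* c _)))

module _ (p q : ℕ) (pos : TPositive p q) where

  private
    F = Tfact p q

    Tfact-nonZero : ∀ m → NonZero (F m)
    Tfact-nonZero m = >-nonZero (Tfact-pos pos m)

  Tbinom-*-/1 : ∀ {n k} m c → k ≤ n → F n ℕ.* m ≡ c ℕ.* (F k ℕ.* F (n ∸ k)) →
                Tbinom p q pos n k * ((+ m) / 1) ≡ (+ c) / 1
  Tbinom-*-/1 {n} {k} m c k≤n eq with k ≤? n
  ... | yes _   = /-*-/1 (F n) _ m c {{ℕₚ.m*n≢0 (F k) (F (n ∸ k)) {{Tfact-nonZero k}} {{Tfact-nonZero (n ∸ k)}}}} eq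
  ... | no  k≰n = contradiction k≤n k≰n

  Tbinom-> : ∀ {n k} → n < k → Tbinom p q pos n k ≡ 0ℚ
  Tbinom-> {n} {k} n<k with k ≤? n
  ... | yes k≤n = contradiction n<k (ℕₚ.≤⇒≯ k≤n)
  ... | no  _   = refl

  Tbinom-complete : ∀ n k → Tbinom p q pos (n + k) k ≡ (+ complete (suc n) k (balls p q (suc n))) / 1
  Tbinom-complete n k = trans (sym (ℚₚ.*-identityʳ _)) (Tbinom-*-/1 1 h (ℕₚ.m≤n+m k n) factorial-identity)
    where
    open ≡-Reasoning
    h = complete (suc n) k (balls p q (suc n))
    factorial-identity : F (n + k) ℕ.* 1 ≡ h ℕ.* (F k ℕ.* F (n + k ∸ k))
    factorial-identity = begin
      F (n + k) ℕ.* 1               ≡⟨ ℕₚ.*-identityʳ (F (n + k)) ⟩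
      F (n + k)                     ≡⟨ complete-balls-Tfact p q k n ⟨
      h ℕ.* F k ℕ.* F n             ≡⟨ ℕₚ.*-assoc h (F k) (F n) ⟩
      h ℕ.* (F k ℕ.* F n)           ≡⟨ cong (λ m → h ℕ.* (F k ℕ.* F m)) (ℕₚ.m+n∸n≡m n k) ⟨
      h ℕ.* (F k ℕ.* F (n + k ∸ k)) ∎

  Tbinom-elementary : ∀ n k → Tbinom p q pos n k * ((+ weight p q k) / 1) ≡ (+ elementary n k (balls p q n)) / 1
  Tbinom-elementary n k with ℕₚ.≤-<-connex k n
  ... | inj₁ k≤n = Tbinom-*-/1 (weight p q k) (e n) k≤n
                     (subst (λ N → F N ℕ.* weight p q k ≡ e N ℕ.* (F k ℕ.* F m)) (ℕₚ.m∸n+n≡m k≤n) identity)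
    where
    m = n ∸ k
    e = λ N → elementary N k (balls p q N)
    identity : F (m + k) ℕ.* weight p q k ≡ e (m + k) ℕ.* (F k ℕ.* F m)
    identity = trans (sym (elementary-balls-Tfact p q m k)) (ℕₚ.*-assoc (e (m + k)) (F k) (F m))
  ... | inj₂ n<k = begin
    Tbinom p q pos n k * w                 ≡⟨ cong (_* w) (Tbinom-> n<k) ⟩
    0ℚ * w                                 ≡⟨ ℚₚ.*-zeroˡ w ⟩
    0ℚ                                     ≡⟨ cong (λ e → (+ e) / 1) (elementary-vanishes n k (balls p q n) n<k) ⟨
    (+ elementary n k (balls p q n)) / 1   ∎
    where
    open ≡-Reasoning
    w = (+ weight p q k) / 1

corollary3 : (p q : ℕ) (pos : TPositive p q) (n k : ℕ) → 1 ≤ n →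
    (Σ ℕ λ c → (Tbinom p q pos (n + k ∸ 1) k ≡ (+ c) / 1) × (Fin c ↔ SelRep p q n k))
    × (Σ ℕ λ c → (Tbinom p q pos n k * ((+ (q ^ (k C 2) ℕ.* p ^ (k C 2))) / 1) ≡ (+ c) / 1) × (Fin c ↔ SelNoRep p q n k))
corollary3 p q pos 0       k ()
corollary3 p q pos (suc n) k _ =
    (complete (suc n) k λⁿ , Tbinom-complete p q pos n k , Fin-complete↔Sel≤ (suc n) k λⁿ)
  , (elementary (suc n) k λⁿ , Tbinom-elementary p q pos (suc n) k , Fin-elementary↔Sel< (suc n) k λⁿ)
  where λⁿ = balls p q (suc n)
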